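{- Let $G$ be a finite, simple, connected graph which is neither a path graph nor an extended star graph. Then for every integer $k\geq 1$, $G$ is circularly $k$-partite if and only if $k$ divides $\chi^o(G)$.
   Context: All graphs are finite, simple (undirected, no loops, no multi-edges) and connected. A path graph is a graph consisting of a single path. An extended star graph is a tree with exactly one vertex of degree $\geq3$. An oriented edge $[v,w]$ is an edge $\{v,w\}$ with input $v$ and output $w$; $\mathcal{O}=\{[v,w],[w,v]: v\sim w\}$. For $k\geq 1$, $G$ is circularly $k$-partite if $\mathcal{O}$ can be partitioned as $\mathcal{O}=\mathcal{O}_1\sqcup\cdots\sqcup\mathcal{O}_k$ with all $\mathcal{O}_j$ non-empty and such that $[v,w]\in\mathcal{O}_j$ implies $[w,z]\in\mathcal{O}_{j+1}$ for every $z\sim w$ with $z\neq v$, indices modulo $k$. The oriented edge periodic colouring number $\chi^o(G)$ is the largest $k$ such that $G$ is circularly $k$-partite. -}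

module Defs where

open import Data.Nat using (ℕ; zero; suc; _≤_; _<_; _%_)
open import Data.Nat.Divisibility using (_∣_)
open import Data.Fin using (Fin; toℕ; inject₁; fromℕ) renaming (zero to fzero; suc to fsuc)
open import Data.Bool using (Bool; true; false; if_then_else_)
open import Data.List using (List; map; allFin)
open import Data.Nat.ListAction using (sum)
open import Data.Sum using (_⊎_)
open import Data.Product using (Σ; _×_; _,_; ∃; ∃-syntax)
open import Data.Empty using (⊥)
open import Relation.Nullary using (¬_)
open import Relation.Binary.PropositionalEquality using (_≡_)
open import Function.Definitions using (Injective; Bijective)
open import Function.Bundles using (_⇔_)

record Graph : Set where
  field
    n      : ℕ
    adj    : Fin n → Fin n → Bool
    sym    : ∀ u v → adj u v ≡ adj v u
    irrefl : ∀ v → adj v v ≡ false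

open Graph public


Adj : (G : Graph) → Fin (n G) → Fin (n G) → Set
Adj G v w = adj G v w ≡ true

data Reach (G : Graph) : Fin (n G) → Fin (n G) → Set where
  here : ∀ {v} → Reach G v v
  step : ∀ {u w v} → Adj G u w → Reach G w v → Reach G u v

Connected : Graph → Set
Connected G = (0 < n G) × (∀ u v → Reach G u v)

deg : (G : Graph) → Fin (n G) → ℕ
deg G v = sum (map (λ w → if adj G v w then 1 else 0) (allFin (n G)))

-- a cycle of length m+3 ≥ 3: distinct vertices f 0, …, f (m+2),
-- consecutive ones adjacent and the last adjacent to the first
HasCycle : Graph → Set
HasCycle G = Σ ℕ λ m → Σ (Fin (suc (suc (suc m))) → Fin (n G)) λ f →
  Injective _≡_ _≡_ f
  × (∀ (i : Fin (suc (suc m))) → Adj G (f (inject₁ i)) (f (fsuc i)))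
  × Adj G (f (fromℕ (suc (suc m)))) (f fzero)

IsTree : Graph → Set
IsTree G = Connected G × ¬ HasCycle G

IsPathGraph : Graph → Set
IsPathGraph G = Σ (Fin (n G) → Fin (n G)) λ σ → Bijective _≡_ _≡_ σ ×
  (∀ i j → Adj G (σ i) (σ j) ⇔ ((toℕ j ≡ suc (toℕ i)) ⊎ (toℕ i ≡ suc (toℕ j))))
  where open import Data.Sum using () renaming (_⊎_ to _⊎_)

IsExtendedStar : Graph → Set
IsExtendedStar G = IsTree G ×
  (∃[ v ] ((3 ≤ deg G v) × (∀ w → 3 ≤ deg G w → w ≡ v)))

-- An oriented-edge colouring c : 𝒪 → Fin k (𝒪ⱼ = c⁻¹(j)), with every
-- class non-empty and [v,w] ∈ 𝒪ⱼ ⇒ [w,z] ∈ 𝒪ⱼ₊₁ (mod k) for z ∼ w, z ≠ v.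
-- Only defined for k ≥ 1; for k = 0 we set it to ⊥.
CircularlyPartite : Graph → ℕ → Set
CircularlyPartite G zero = ⊥
CircularlyPartite G (suc k) =
  Σ ((v w : Fin (n G)) → Adj G v w → Fin (suc k)) λ c →
    (∀ (j : Fin (suc k)) → ∃[ v ] ∃[ w ] Σ (Adj G v w) λ p → c v w p ≡ j)
    × (∀ v w z (p : Adj G v w) (q : Adj G w z) → ¬ (z ≡ v) →
         toℕ (c w z q) ≡ suc (toℕ (c v w p)) % suc k)

IsChiO : Graph → ℕ → Set
IsChiO G m = CircularlyPartite G m × (∀ k → CircularlyPartite G k → k ≤ m)

{-# OPTIONS --safe #-}
module Submission where

-- Call an oriented edge [w,z] forced by [v,w] if every circular colouring gives it the colour
-- following that of [v,w]. This holds if z ≠ v, and also if w has degree ≥ 3, since two further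
-- neighbours of w tie the colours together. Along an infinite sequence of successively forced
-- oriented edges a circular k-colouring runs through all k colours, so every such colouring is onto.
-- A connected graph that is neither a path nor an extended star carries such a sequence: go round
-- a cycle, bounce between two vertices of degree ≥ 3, or (minimum degree ≥ 2) never backtrack.
-- Circular colourings modulo k and modulo m then combine, by the Chinese remainder theorem, into
-- one modulo lcm(k, m), so lcm(k, m) ≤ χᵒ(G); hence k ∣ χᵒ(G). Conversely, reducing a circular
-- colouring modulo a divisor of the number of colours keeps it circular.

open import Defs hiding (sym)

open import Data.Bool as Bool using (Bool; true; false; if_then_else_)
open import Data.Fin using (Fin; toℕ; fromℕ<; zero; suc)
open import Data.Fin.Properties using (any?; injective⇒≤; toℕ-fromℕ<; toℕ-fromℕ; toℕ-inject₁; toℕ<n; toℕ-injective) renaming (_≟_ to _≟ᶠ_)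
open import Data.Fin.Subset using (Subset; inside; outside; ∣_∣; _∈_; _∉_; _⊆_; _∪_; _-_; ⁅_⁆)
open import Data.Fin.Subset.Properties using (_∈?_; p⊆q⇒∣p∣≤∣q∣; ∣⁅x⁆∣≡1; x∈⁅x⁆; x∈p∪q⁺; x∈p⇒∣p-x∣<∣p∣; x∈p∧x≢y⇒x∈p-y)
open import Data.List using (map; allFin)
import Data.List as List
open import Data.List.Properties using (map-tabulate)
open import Data.Nat hiding (∣_-_∣)
open import Data.Nat.DivMod
open import Data.Nat.Divisibility using (_∣_; _∣?_; divides; ∣⇒≤; ∣-trans; n∣m*n)
open import Data.Nat.GCD using (gcd; gcd-GCD; gcd[m,n]∣m; gcd[m,n]∣n; gcd[m,n]≢0; module Bézout)
open import Data.Nat.LCM using (lcm; gcd*lcm; lcm-least; m∣lcm[m,n]; n∣lcm[m,n])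
open import Data.Nat.ListAction using (sum)
open import Data.Nat.Properties
open import Data.Nat.Tactic.RingSolver using (solve-∀)
open import Data.Product using (∃; ∃₂; Σ; _×_; _,_; proj₁; proj₂)
open import Data.Sum using (_⊎_; inj₁; inj₂)
open import Data.Unit using (⊤; tt)
open import Data.Vec using (_∷_; []; tabulate)
open import Data.Vec.Properties using (lookup∘tabulate; lookup⇒[]=; []=⇒lookup)
open import Function using (id; _∘_; case_of_)
open import Function.Bundles using (_⇔_; mk⇔)
open import Relation.Binary.PropositionalEquality
open import Relation.Nullary using (¬_; Dec; ¬¬-map; yes; no; contradiction)
open import Relation.Nullary.Decidable using (¬?; _×-dec_; decidable-stable)

-- Congruences and the Chinese remainder theorem

%-≡⇒∣∸ : ∀ a b n .{{_ : NonZero n}} → a % n ≡ b % n → n ∣ b ∸ a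
%-≡⇒∣∸ a b n eq = divides (b / n ∸ a / n) (begin
  b ∸ a                                     ≡⟨ cong₂ _∸_ (m≡m%n+[m/n]*n b n) (m≡m%n+[m/n]*n a n) ⟩
  (b % n + b / n * n) ∸ (a % n + a / n * n) ≡⟨ cong (λ r → (b % n + b / n * n) ∸ (r + a / n * n)) eq ⟩
  (b % n + b / n * n) ∸ (b % n + a / n * n) ≡⟨ [m+n]∸[m+o]≡n∸o (b % n) (b / n * n) (a / n * n) ⟩
  b / n * n ∸ a / n * n                     ≡⟨ *-distribʳ-∸ n (b / n) (a / n) ⟨
  (b / n ∸ a / n) * n                       ∎)
  where open ≡-Reasoning

∣∸⇒%-≡ : ∀ {a b} n .{{_ : NonZero n}} → a ≤ b → n ∣ b ∸ a → a % n ≡ b % n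
∣∸⇒%-≡ {a} {b} n a≤b n∣b∸a = begin
  a % n             ≡⟨ %-remove-+ʳ a n∣b∸a ⟨
  (a + (b ∸ a)) % n ≡⟨ cong (_% n) (m+[n∸m]≡n a≤b) ⟩
  b % n             ∎
  where open ≡-Reasoning

%-≡-lcm : ∀ {a b} k m .{{_ : NonZero k}} .{{_ : NonZero m}} .{{_ : NonZero (lcm k m)}} →
          a % k ≡ b % k → a % m ≡ b % m → a % lcm k m ≡ b % lcm k m
%-≡-lcm {a} {b} k m eqₖ eqₘ with ≤-total a b
... | inj₁ a≤b = ∣∸⇒%-≡ (lcm k m) a≤b (lcm-least (%-≡⇒∣∸ a b k eqₖ) (%-≡⇒∣∸ a b m eqₘ))
... | inj₂ b≤a = sym (∣∸⇒%-≡ (lcm k m) b≤a (lcm-least (%-≡⇒∣∸ b a k (sym eqₖ)) (%-≡⇒∣∸ b a m (sym eqₘ))))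

%-≡-+ : ∀ {a a′ b b′} n .{{_ : NonZero n}} → a % n ≡ a′ % n → b % n ≡ b′ % n → (a + b) % n ≡ (a′ + b′) % n
%-≡-+ {a} {a′} {b} {b′} n eqa eqb = begin
  (a + b) % n           ≡⟨ %-distribˡ-+ a b n ⟩
  (a % n + b % n) % n   ≡⟨ cong₂ (λ r s → (r + s) % n) eqa eqb ⟩
  (a′ % n + b′ % n) % n ≡⟨ %-distribˡ-+ a′ b′ n ⟨
  (a′ + b′) % n         ∎
  where open ≡-Reasoning

%-≡-*ˡ : ∀ {b b′} c n .{{_ : NonZero n}} → b % n ≡ b′ % n → (c * b) % n ≡ (c * b′) % n
%-≡-*ˡ {b} {b′} c n eq = begin
  (c * b) % n            ≡⟨ %-distribˡ-* c b n ⟩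
  (c % n * (b % n)) % n  ≡⟨ cong (λ r → (c % n * r) % n) eq ⟩
  (c % n * (b′ % n)) % n ≡⟨ %-distribˡ-* c b′ n ⟨
  (c * b′) % n           ∎
  where open ≡-Reasoning

suc-%-≡ : ∀ {a b} n .{{_ : NonZero n}} → a % n ≡ b % n → suc a % n ≡ suc b % n
suc-%-≡ n = %-≡-+ {1} n refl

%-≡-∣ : ∀ {a b d} n .{{_ : NonZero d}} .{{_ : NonZero n}} → d ∣ n → a % n ≡ b % n → a % d ≡ b % d
%-≡-∣ {a} {b} {d} n d∣n eq = begin
  a % d     ≡⟨ m∣n⇒o%n%m≡o%m d n a d∣n ⟨
  a % n % d ≡⟨ cong (_% d) eq ⟩
  b % n % d ≡⟨ m∣n⇒o%n%m≡o%m d n b d∣n ⟩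
  b % d     ∎
  where open ≡-Reasoning

[1+m%n]%n≡[1+m]%n : ∀ m n .{{_ : NonZero n}} → suc (m % n) % n ≡ suc m % n
[1+m%n]%n≡[1+m]%n m n = suc-%-≡ n (m%n%n≡m%n m n)

%-≡⇒≡+multiple : ∀ {a b} n .{{_ : NonZero n}} → a ≤ b → a % n ≡ b % n → ∃ λ q → b ≡ a + q * n
%-≡⇒≡+multiple {a} {b} n a≤b eq with %-≡⇒∣∸ a b n eq
... | divides q b∸a≡q*n = q , trans (sym (m+[n∸m]≡n a≤b)) (cong (a +_) b∸a≡q*n)

crt-oriented : ∀ {k m g} x y a b .{{_ : NonZero k}} .{{_ : NonZero m}} .{{_ : NonZero g}} →
               g ∣ m → g + y * m ≡ x * k → a % g ≡ b % g →
               ∃ λ t → t % k ≡ a % k × t % m ≡ b % m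
crt-oriented {k} {m} {g} x y a b g∣m bézout eq = t , [m+kn]%n≡m%n a (q * x) k , (begin
  t % m                       ≡⟨ cong (_% m) t≡b′+qym ⟩
  (b + a * m + q * y * m) % m ≡⟨ [m+kn]%n≡m%n (b + a * m) (q * y) m ⟩
  (b + a * m) % m             ≡⟨ [m+kn]%n≡m%n b a m ⟩
  b % m                       ∎)
  where
  open ≡-Reasoning
  -- b is raised to b′ = b + a m ≥ a, which lies in the class of b modulo m and modulo g.
  b′ : ℕ
  b′ = b + a * m
  b′≡a+qg : ∃ λ q → b′ ≡ a + q * g
  b′≡a+qg = %-≡⇒≡+multiple g (≤-trans (m≤m*n a m) (m≤n+m (a * m) b))
                           (trans eq (sym (%-remove-+ʳ b (∣-trans g∣m (n∣m*n a)))))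
  q t : ℕ
  q = proj₁ b′≡a+qg
  t = a + q * x * k
  t≡b′+qym : t ≡ b′ + q * y * m
  t≡b′+qym = begin
    a + q * x * k         ≡⟨ cong (a +_) (*-assoc q x k) ⟩
    a + q * (x * k)       ≡⟨ cong (λ r → a + q * r) bézout ⟨
    a + q * (g + y * m)   ≡⟨ distribute a q g y m ⟩
    a + q * g + q * y * m ≡⟨ cong (_+ q * y * m) (proj₂ b′≡a+qg) ⟨
    b′ + q * y * m        ∎
    where
    distribute : ∀ a q g y m → a + q * (g + y * m) ≡ a + q * g + q * y * m
    distribute = solve-∀

gcd≢0 : ∀ k m .{{_ : NonZero k}} → NonZero (gcd k m)
gcd≢0 k m = ≢-nonZero (gcd[m,n]≢0 k m (inj₁ (≢-nonZero⁻¹ k)))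

lcm≢0 : ∀ k m .{{_ : NonZero k}} .{{_ : NonZero m}} → NonZero (lcm k m)
lcm≢0 k m = ≢-nonZero λ lcm≡0 → ≢-nonZero⁻¹ (k * m) {{m*n≢0 k m}} (begin
  k * m               ≡⟨ gcd*lcm k m ⟨
  gcd k m * lcm k m   ≡⟨ cong (gcd k m *_) lcm≡0 ⟩
  gcd k m * 0         ≡⟨ *-zeroʳ (gcd k m) ⟩
  0                   ∎)
  where open ≡-Reasoning

module _ (k m : ℕ) .{{_ : NonZero k}} .{{_ : NonZero m}} where

  private instance
    gcd-nonZero : NonZero (gcd k m)
    gcd-nonZero = gcd≢0 k m
    lcm-nonZero : NonZero (lcm k m)
    lcm-nonZero = lcm≢0 k m

  crt : ∀ a b → a % gcd k m ≡ b % gcd k m → ∃ λ t → t % k ≡ a % k × t % m ≡ b % m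
  crt a b eq with Bézout.identity (gcd-GCD k m)
  ... | Bézout.+- x y bézout = crt-oriented x y a b (gcd[m,n]∣n k m) bézout eq
  ... | Bézout.-+ x y bézout with crt-oriented y x b a (gcd[m,n]∣m k m) bézout (sym eq)
  ...   | t , t≡b , t≡a = t , t≡a , t≡b

  -- diff x y ≡ y − x modulo gcd k m, since pred (gcd k m) acts as −1.
  diff : ℕ → ℕ → ℕ
  diff x y = (y + pred (gcd k m) * x) % gcd k m

  private
    g : ℕ
    g = gcd k m

    pred-g-inverse : ∀ x y → x + (y + pred g * x) ≡ y + x * g
    pred-g-inverse x y = begin
      x + (y + pred g * x)  ≡⟨ rearrange x y (pred g) ⟩
      y + x * suc (pred g)  ≡⟨ cong (λ h → y + x * h) (suc-pred g) ⟩
      y + x * g             ∎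
      where
      open ≡-Reasoning
      rearrange : ∀ x y p → x + (y + p * x) ≡ y + x * suc p
      rearrange = solve-∀

  +-diff : ∀ x y → (x + diff x y) % g ≡ y % g
  +-diff x y = begin
    (x + diff x y) % g          ≡⟨ %-≡-+ g refl (m%n%n≡m%n (y + pred g * x) g) ⟩
    (x + (y + pred g * x)) % g  ≡⟨ cong (_% g) (pred-g-inverse x y) ⟩
    (y + x * g) % g             ≡⟨ [m+kn]%n≡m%n y x g ⟩
    y % g                       ∎
    where open ≡-Reasoning

  diff-cong : ∀ {x x′ y y′} → x % g ≡ x′ % g → y % g ≡ y′ % g → diff x y ≡ diff x′ y′
  diff-cong eqx eqy = %-≡-+ g eqy (%-≡-*ˡ (pred g) g eqx)

  diff-suc : ∀ x y → diff (suc x) (suc y) ≡ diff x y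
  diff-suc x y = begin
    (suc y + pred g * suc x) % g  ≡⟨ cong (_% g) (shift x y) ⟩
    (y + pred g * x + g) % g      ≡⟨ [m+n]%n≡m%n (y + pred g * x) g ⟩
    (y + pred g * x) % g          ∎
    where
    open ≡-Reasoning
    shift : ∀ x y → suc y + pred g * suc x ≡ y + pred g * x + g
    shift x y = begin
      suc y + pred g * suc x         ≡⟨ rearrange x y (pred g) ⟩
      y + pred g * x + suc (pred g)  ≡⟨ cong (y + pred g * x +_) (suc-pred g) ⟩
      y + pred g * x + g             ∎
      where
      rearrange : ∀ x y p → suc y + p * suc x ≡ y + p * x + suc p
      rearrange = solve-∀

  pairing : ℕ → ℕ → ℕ
  pairing x y = proj₁ (crt (x + diff x y) y (+-diff x y))

  pairing-suc : ∀ {x x′ y y′} → x′ % k ≡ suc x % k → y′ % m ≡ suc y % m →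
                pairing x′ y′ % lcm k m ≡ suc (pairing x y) % lcm k m
  pairing-suc {x} {x′} {y} {y′} eqx eqy = %-≡-lcm k m modk modm
    where
    open ≡-Reasoning
    solution : ∀ x y → pairing x y % k ≡ (x + diff x y) % k × pairing x y % m ≡ y % m
    solution x y = proj₂ (crt (x + diff x y) y (+-diff x y))
    diff≡ : diff x′ y′ ≡ diff x y
    diff≡ = trans (diff-cong (%-≡-∣ k (gcd[m,n]∣m k m) eqx) (%-≡-∣ m (gcd[m,n]∣n k m) eqy)) (diff-suc x y)
    modk : pairing x′ y′ % k ≡ suc (pairing x y) % k
    modk = begin
      pairing x′ y′ % k          ≡⟨ proj₁ (solution x′ y′) ⟩
      (x′ + diff x′ y′) % k      ≡⟨ %-≡-+ k eqx (cong (_% k) diff≡) ⟩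
      (suc x + diff x y) % k     ≡⟨ suc-%-≡ k (proj₁ (solution x y)) ⟨
      suc (pairing x y) % k      ∎
    modm : pairing x′ y′ % m ≡ suc (pairing x y) % m
    modm = begin
      pairing x′ y′ % m          ≡⟨ proj₂ (solution x′ y′) ⟩
      y′ % m                     ≡⟨ eqy ⟩
      suc y % m                  ≡⟨ suc-%-≡ m (proj₂ (solution x y)) ⟨
      suc (pairing x y) % m      ∎

-- Neighbourhoods and degrees

∣p∪q∣≤∣p∣+∣q∣ : ∀ {n} (p q : Subset n) → ∣ p ∪ q ∣ ≤ ∣ p ∣ + ∣ q ∣
∣p∪q∣≤∣p∣+∣q∣ []           []           = z≤n
∣p∪q∣≤∣p∣+∣q∣ (inside ∷ p) (inside ∷ q)  = s≤s (≤-trans (∣p∪q∣≤∣p∣+∣q∣ p q) (+-monoʳ-≤ ∣ p ∣ (n≤1+n ∣ q ∣)))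
∣p∪q∣≤∣p∣+∣q∣ (inside ∷ p) (outside ∷ q) = s≤s (∣p∪q∣≤∣p∣+∣q∣ p q)
∣p∪q∣≤∣p∣+∣q∣ (outside ∷ p) (inside ∷ q) = ≤-trans (s≤s (∣p∪q∣≤∣p∣+∣q∣ p q)) (≤-reflexive (sym (+-suc ∣ p ∣ ∣ q ∣)))
∣p∪q∣≤∣p∣+∣q∣ (outside ∷ p) (outside ∷ q) = ∣p∪q∣≤∣p∣+∣q∣ p q

sum-indicator≡∣tabulate∣ : ∀ {n} (f : Fin n → Bool) →
                           sum (map (λ w → if f w then 1 else 0) (allFin n)) ≡ ∣ tabulate f ∣
sum-indicator≡∣tabulate∣ {n} f = trans (cong sum (map-tabulate {n = n} id (λ w → if f w then 1 else 0))) (count f)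
  where
  count : ∀ {n} (f : Fin n → Bool) → sum (List.tabulate (λ w → if f w then 1 else 0)) ≡ ∣ tabulate f ∣
  count {zero}  f = refl
  count {suc n} f with f zero
  ... | true  = cong suc (count (f ∘ suc))
  ... | false = count (f ∘ suc)

module _ (G : Graph) where

  Vertex : Set
  Vertex = Fin (n G)

  Adj-sym : ∀ {v w} → Adj G v w → Adj G w v
  Adj-sym {v} {w} = trans (Graph.sym G w v)

  Adj-irrefl : ∀ {v} → ¬ Adj G v v
  Adj-irrefl {v} p with () ← trans (sym (irrefl G v)) p

  neighbourhood : Vertex → Subset (n G)
  neighbourhood v = tabulate (adj G v)

  Adj⇒∈neighbourhood : ∀ {v w} → Adj G v w → w ∈ neighbourhood v
  Adj⇒∈neighbourhood {v} {w} p = lookup⇒[]= w (neighbourhood v) (trans (lookup∘tabulate (adj G v) w) p)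

  ∈neighbourhood⇒Adj : ∀ {v w} → w ∈ neighbourhood v → Adj G v w
  ∈neighbourhood⇒Adj {v} {w} w∈N = trans (sym (lookup∘tabulate (adj G v) w)) ([]=⇒lookup w∈N)

  deg≡∣neighbourhood∣ : ∀ v → deg G v ≡ ∣ neighbourhood v ∣
  deg≡∣neighbourhood∣ v = sum-indicator≡∣tabulate∣ (adj G v)

  ∃-neighbour-∉ : ∀ {v} (S : Subset (n G)) → ∣ S ∣ < deg G v → ∃ λ w → Adj G v w × w ∉ S
  ∃-neighbour-∉ {v} S ∣S∣<deg with any? (λ w → (adj G v w Bool.≟ true) ×-dec ¬? (w ∈? S))
  ... | yes found = found
  ... | no none = contradiction (p⊆q⇒∣p∣≤∣q∣ N⊆S) (<⇒≱ (subst (∣ S ∣ <_) (deg≡∣neighbourhood∣ v) ∣S∣<deg))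
    where
    N⊆S : neighbourhood v ⊆ S
    N⊆S {w} w∈N = decidable-stable (w ∈? S) (λ w∉S → none (w , ∈neighbourhood⇒Adj w∈N , w∉S))

  other-neighbour : ∀ {v} x → 2 ≤ deg G v → ∃ λ w → Adj G v w × w ≢ x
  other-neighbour x 2≤deg with ∃-neighbour-∉ ⁅ x ⁆ (subst (_< _) (sym (∣⁅x⁆∣≡1 x)) 2≤deg)
  ... | w , p , w∉⁅x⁆ = w , p , λ { refl → w∉⁅x⁆ (x∈⁅x⁆ w) }

  two-other-neighbours : ∀ {v} x → 3 ≤ deg G v →
                         ∃₂ λ a b → Adj G v a × Adj G v b × a ≢ b × a ≢ x × b ≢ x
  two-other-neighbours x 3≤deg with other-neighbour x (≤-trans (n≤1+n 2) 3≤deg)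
  ... | a , pa , a≢x with ∃-neighbour-∉ (⁅ x ⁆ ∪ ⁅ a ⁆) (≤-trans (s≤s ∣⁅x⁆∪⁅a⁆∣≤2) 3≤deg)
    where
    ∣⁅x⁆∪⁅a⁆∣≤2 : ∣ ⁅ x ⁆ ∪ ⁅ a ⁆ ∣ ≤ 2
    ∣⁅x⁆∪⁅a⁆∣≤2 = ≤-trans (∣p∪q∣≤∣p∣+∣q∣ ⁅ x ⁆ ⁅ a ⁆) (≤-reflexive (cong₂ _+_ (∣⁅x⁆∣≡1 x) (∣⁅x⁆∣≡1 a)))
  ... | b , pb , b∉ = a , b , pa , pb , (λ { refl → b∉ (x∈p∪q⁺ (inj₂ (x∈⁅x⁆ a))) }) , a≢x ,
                      λ { refl → b∉ (x∈p∪q⁺ (inj₁ (x∈⁅x⁆ x))) }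

  2≤deg : ∀ {v a b} → Adj G v a → Adj G v b → b ≢ a → 2 ≤ deg G v
  2≤deg {v} {a} {b} pa pb b≢a = subst (2 ≤_) (sym (deg≡∣neighbourhood∣ v)) (begin
    2                                ≤⟨ s≤s (≤-trans (s≤s z≤n) (x∈p⇒∣p-x∣<∣p∣ b∈N-a)) ⟩
    suc ∣ neighbourhood v - a ∣       ≤⟨ x∈p⇒∣p-x∣<∣p∣ (Adj⇒∈neighbourhood pa) ⟩
    ∣ neighbourhood v ∣               ∎)
    where
    open ≤-Reasoning
    b∈N-a : b ∈ neighbourhood v - a
    b∈N-a = x∈p∧x≢y⇒x∈p-y (Adj⇒∈neighbourhood pb) b≢a

  3≤deg : ∀ {v a b c} → Adj G v a → Adj G v b → Adj G v c → b ≢ a → c ≢ a → c ≢ b → 3 ≤ deg G v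
  3≤deg {v} {a} {b} {c} pa pb pc b≢a c≢a c≢b = subst (3 ≤_) (sym (deg≡∣neighbourhood∣ v)) (begin
    3                                   ≤⟨ s≤s (s≤s (≤-trans (s≤s z≤n) (x∈p⇒∣p-x∣<∣p∣ c∈N-a-b))) ⟩
    suc (suc ∣ neighbourhood v - a - b ∣) ≤⟨ s≤s (x∈p⇒∣p-x∣<∣p∣ b∈N-a) ⟩
    suc ∣ neighbourhood v - a ∣          ≤⟨ x∈p⇒∣p-x∣<∣p∣ (Adj⇒∈neighbourhood pa) ⟩
    ∣ neighbourhood v ∣                  ∎)
    where
    open ≤-Reasoning
    b∈N-a : b ∈ neighbourhood v - a
    b∈N-a = x∈p∧x≢y⇒x∈p-y (Adj⇒∈neighbourhood pb) b≢a
    c∈N-a-b : c ∈ neighbourhood v - a - b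
    c∈N-a-b = x∈p∧x≢y⇒x∈p-y (x∈p∧x≢y⇒x∈p-y (Adj⇒∈neighbourhood pc) c≢a) c≢b

  neighbour-unique : ∀ {v a z} → deg G v ≤ 1 → Adj G v a → Adj G v z → z ≡ a
  neighbour-unique {a = a} {z} deg≤1 pa pz with z ≟ᶠ a
  ... | yes z≡a = z≡a
  ... | no z≢a  = contradiction deg≤1 (<⇒≱ (2≤deg pa pz z≢a))

  neighbour-one-of-two : ∀ {v a b z} → deg G v ≤ 2 → Adj G v a → Adj G v b → b ≢ a → Adj G v z → z ≡ a ⊎ z ≡ b
  neighbour-one-of-two {a = a} {b} {z} deg≤2 pa pb b≢a pz with z ≟ᶠ a | z ≟ᶠ b
  ... | yes z≡a | _       = inj₁ z≡a
  ... | no _    | yes z≡b = inj₂ z≡b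
  ... | no z≢a  | no z≢b  = contradiction deg≤2 (<⇒≱ (3≤deg pa pb pz b≢a z≢a z≢b))

  -- Circular colourings

  Colouring : ℕ → Set
  Colouring K = (v w : Vertex) → Adj G v w → Fin K

  Labelling : Set
  Labelling = (v w : Vertex) → Adj G v w → ℕ

  IsCircular : ∀ {K} .{{_ : NonZero K}} → Colouring K → Set
  IsCircular {K} c = ∀ v w z (p : Adj G v w) (q : Adj G w z) → z ≢ v →
                     toℕ (c w z q) ≡ suc (toℕ (c v w p)) % K

  IsCircularModulo : (K : ℕ) .{{_ : NonZero K}} → Labelling → Set
  IsCircularModulo K ℓ = ∀ v w z (p : Adj G v w) (q : Adj G w z) → z ≢ v →
                         ℓ w z q % K ≡ suc (ℓ v w p) % K

  Onto : ∀ {K} → Colouring K → Set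
  Onto {K} c = ∀ (j : Fin K) → ∃ λ v → ∃ λ w → Σ (Adj G v w) λ p → c v w p ≡ j

  labels : ∀ {K} → Colouring K → Labelling
  labels c v w p = toℕ (c v w p)

  residues : (K : ℕ) .{{_ : NonZero K}} → Labelling → Colouring K
  residues K ℓ v w p = fromℕ< (m%n<n (ℓ v w p) K)

  labels-circular : ∀ {K} .{{_ : NonZero K}} {c : Colouring K} → IsCircular c → IsCircularModulo K (labels c)
  labels-circular {K} circ v w z p q z≢v =
    trans (cong (_% K) (circ v w z p q z≢v)) (m%n%n≡m%n _ K)

  circularModulo-∣ : ∀ {d K} .{{_ : NonZero d}} .{{_ : NonZero K}} {ℓ : Labelling} →
                     d ∣ K → IsCircularModulo K ℓ → IsCircularModulo d ℓ
  circularModulo-∣ {K = K} d∣K circ v w z p q z≢v = %-≡-∣ K d∣K (circ v w z p q z≢v)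

  circularModulo-lcm : ∀ {k m} .{{_ : NonZero k}} .{{_ : NonZero m}} {ℓ₁ ℓ₂ : Labelling} →
                       IsCircularModulo k ℓ₁ → IsCircularModulo m ℓ₂ →
                       IsCircularModulo (lcm k m) {{lcm≢0 k m}} (λ v w p → pairing k m (ℓ₁ v w p) (ℓ₂ v w p))
  circularModulo-lcm {k} {m} circ₁ circ₂ v w z p q z≢v =
    pairing-suc k m (circ₁ v w z p q z≢v) (circ₂ v w z p q z≢v)

  residues-circular : ∀ {K} .{{_ : NonZero K}} {ℓ : Labelling} → IsCircularModulo K ℓ → IsCircular (residues K ℓ)
  residues-circular {K} {ℓ} circ v w z p q z≢v = begin
    toℕ (residues K ℓ w z q)          ≡⟨ toℕ-fromℕ< _ ⟩
    ℓ w z q % K                       ≡⟨ circ v w z p q z≢v ⟩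
    suc (ℓ v w p) % K                 ≡⟨ [1+m%n]%n≡[1+m]%n (ℓ v w p) K ⟨
    suc (ℓ v w p % K) % K             ≡⟨ cong (λ r → suc r % K) (toℕ-fromℕ< _) ⟨
    suc (toℕ (residues K ℓ v w p)) % K ∎
    where open ≡-Reasoning

  residues-onto : ∀ {K M} .{{_ : NonZero K}} → K ≤ M → {c : Colouring M} → Onto c → Onto (residues K (labels c))
  residues-onto {K} K≤M {c} onto j with onto (fromℕ< (≤-trans (toℕ<n j) K≤M))
  ... | v , w , p , c≡j = v , w , p , toℕ-injective (begin
    toℕ (residues K (labels c) v w p) ≡⟨ toℕ-fromℕ< _ ⟩
    toℕ (c v w p) % K                 ≡⟨ cong (λ i → toℕ i % K) c≡j ⟩
    toℕ (fromℕ< _) % K                ≡⟨ cong (_% K) (toℕ-fromℕ< _) ⟩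
    toℕ j % K                         ≡⟨ m<n⇒m%n≡m (toℕ<n j) ⟩
    toℕ j                             ∎)
    where open ≡-Reasoning

  -- Forcing sequences

  OrientedEdge : Set
  OrientedEdge = Σ Vertex λ v → Σ Vertex λ w → Adj G v w

  colourOf : ∀ {K} → Colouring K → OrientedEdge → Fin K
  colourOf c (v , w , p) = c v w p

  infix 4 _⇝_
  _⇝_ : OrientedEdge → OrientedEdge → Set
  e ⇝ e′ = ∀ K .{{_ : NonZero K}} (c : Colouring K) → IsCircular c →
           toℕ (colourOf c e′) ≡ suc (toℕ (colourOf c e)) % K

  ForcingSequence : Set
  ForcingSequence = Σ (ℕ → OrientedEdge) λ e → ∀ j → e j ⇝ e (suc j)

  forcing⇒onto : ForcingSequence → ∀ {K} .{{_ : NonZero K}} {c : Colouring K} → IsCircular c → Onto c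
  forcing⇒onto (e , forced) {K} {c} circ j = e i .proj₁ , e i .proj₂ .proj₁ , e i .proj₂ .proj₂ , toℕ-injective (begin
    toℕ (colourOf c (e i))  ≡⟨ along i ⟩
    (c₀ + i) % K            ≡⟨ cong (_% K) c₀+i≡j+K ⟩
    (toℕ j + K) % K         ≡⟨ [m+n]%n≡m%n (toℕ j) K ⟩
    toℕ j % K               ≡⟨ m<n⇒m%n≡m (toℕ<n j) ⟩
    toℕ j                   ∎)
    where
    open ≡-Reasoning
    c₀ : ℕ
    c₀ = toℕ (colourOf c (e 0))
    along : ∀ i → toℕ (colourOf c (e i)) ≡ (c₀ + i) % K
    along zero    = sym (trans (cong (_% K) (+-identityʳ c₀)) (m<n⇒m%n≡m (toℕ<n (colourOf c (e 0)))))
    along (suc i) = begin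
      toℕ (colourOf c (e (suc i)))     ≡⟨ forced i K c circ ⟩
      suc (toℕ (colourOf c (e i))) % K ≡⟨ suc-%-≡ K (trans (cong (_% K) (along i)) (m%n%n≡m%n (c₀ + i) K)) ⟩
      suc (c₀ + i) % K                 ≡⟨ cong (_% K) (+-suc c₀ i) ⟨
      (c₀ + suc i) % K                 ∎
    i : ℕ
    i = toℕ j + (K ∸ c₀)
    c₀+i≡j+K : c₀ + i ≡ toℕ j + K
    c₀+i≡j+K = begin
      c₀ + (toℕ j + (K ∸ c₀)) ≡⟨ exchange c₀ (toℕ j) (K ∸ c₀) ⟩
      toℕ j + (c₀ + (K ∸ c₀)) ≡⟨ cong (toℕ j +_) (m+[n∸m]≡n (<⇒≤ (toℕ<n (colourOf c (e 0))))) ⟩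
      toℕ j + K               ∎
      where
      exchange : ∀ a b r → a + (b + r) ≡ b + (a + r)
      exchange = solve-∀

  ⇝-nonBacktracking : ∀ {v w z} (p : Adj G v w) (q : Adj G w z) → z ≢ v → (v , w , p) ⇝ (w , z , q)
  ⇝-nonBacktracking p q z≢v K c circ = circ _ _ _ p q z≢v

  -- c[w,z] = c[u,w] + 1 = c[w,t] = c[v,w] + 1.
  ⇝-via : ∀ {v w z u t} (p : Adj G v w) (q : Adj G w z) → Adj G w u → Adj G w t →
          z ≢ u → t ≢ u → t ≢ v → (v , w , p) ⇝ (w , z , q)
  ⇝-via p q pu pt z≢u t≢u t≢v K c circ =
    trans (circ _ _ _ (Adj-sym pu) q z≢u) (trans (sym (circ _ _ _ (Adj-sym pu) pt t≢u)) (circ _ _ _ p pt t≢v))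

  ⇝-branch : ∀ {v w z} (p : Adj G v w) (q : Adj G w z) → 3 ≤ deg G w → (v , w , p) ⇝ (w , z , q)
  ⇝-branch {v} {w} {z} p q 3≤deg with two-other-neighbours v 3≤deg
  ... | a , b , pa , pb , a≢b , a≢v , b≢v with z ≟ᶠ a
  ...   | yes refl = ⇝-via p q pb pa a≢b a≢b a≢v
  ...   | no z≢a  = ⇝-via p q pa pb z≢a (a≢b ∘ sym) b≢v

  walk⇒forcing : (h : ℕ → Vertex) → (∀ j → Adj G (h j) (h (suc j))) →
                (∀ j → h (suc (suc j)) ≢ h j ⊎ 3 ≤ deg G (h (suc j))) → ForcingSequence
  walk⇒forcing h adjacent turn = (λ j → h j , h (suc j) , adjacent j) , forced
    where
    forced : ∀ j → (h j , h (suc j) , adjacent j) ⇝ (h (suc j) , h (suc (suc j)) , adjacent (suc j))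
    forced j with turn j
    ... | inj₁ noBacktrack = ⇝-nonBacktracking (adjacent j) (adjacent (suc j)) noBacktrack
    ... | inj₂ branch      = ⇝-branch (adjacent j) (adjacent (suc j)) branch

  cycle⇒forcing : HasCycle G → ForcingSequence
  cycle⇒forcing (m , f , f-injective , consecutive , closing) =
    walk⇒forcing (f ∘ position) adjacent (inj₁ ∘ noBacktracking)
    where
    N : ℕ
    N = 3 + m
    position : ℕ → Fin N
    position j = fromℕ< (m%n<n j N)
    toℕ-position-suc : ∀ j → toℕ (position (suc j)) ≡ suc (toℕ (position j)) % N
    toℕ-position-suc j = begin
      toℕ (position (suc j))       ≡⟨ toℕ-fromℕ< _ ⟩
      suc j % N                    ≡⟨ [1+m%n]%n≡[1+m]%n j N ⟨
      suc (j % N) % N              ≡⟨ cong (λ r → suc r % N) (toℕ-fromℕ< (m%n<n j N)) ⟨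
      suc (toℕ (position j)) % N   ∎
      where open ≡-Reasoning
    adjacent : ∀ j → Adj G (f (position j)) (f (position (suc j)))
    adjacent j with m≤n⇒m<n∨m≡n (toℕ<n (position j))
    ... | inj₁ 1+r<N = subst₂ (λ a b → Adj G (f a) (f b))
      (toℕ-injective (trans (toℕ-inject₁ i) (toℕ-fromℕ< _)))
      (toℕ-injective (trans (cong suc (toℕ-fromℕ< _)) (sym (trans (toℕ-position-suc j) (m<n⇒m%n≡m 1+r<N)))))
      (consecutive i)
      where
      i : Fin (2 + m)
      i = fromℕ< (≤-pred 1+r<N)
    ... | inj₂ 1+r≡N = subst₂ (λ a b → Adj G (f a) (f b))
      (toℕ-injective (trans (toℕ-fromℕ (2 + m)) (sym (suc-injective 1+r≡N))))
      (toℕ-injective (sym (trans (toℕ-position-suc j) (trans (cong (_% N) 1+r≡N) (n%n≡0 N)))))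
      closing
    noBacktracking : ∀ j → f (position (2 + j)) ≢ f (position j)
    noBacktracking j f≡ =
      <⇒≱ (s≤s (s≤s (s≤s z≤n))) (∣⇒≤ (subst (N ∣_) (m+n∸n≡m 2 j) (%-≡⇒∣∸ j (2 + j) N j≡2+j)))
      where
      j≡2+j : j % N ≡ (2 + j) % N
      j≡2+j = trans (sym (toℕ-fromℕ< _)) (trans (cong toℕ (sym (f-injective f≡))) (toℕ-fromℕ< _))

  minDeg≥2⇒forcing : (∀ v → 2 ≤ deg G v) → Vertex → ForcingSequence
  minDeg≥2⇒forcing 2≤deg v₀ =
    walk⇒forcing (proj₁ ∘ trail) adjacent (λ j → inj₁ (proj₂ (proj₂ (continue (trail j)))))
    where
    continue : ((previous , current) : Vertex × Vertex) → ∃ λ w → Adj G current w × w ≢ previous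
    continue (previous , current) = other-neighbour previous (2≤deg current)
    trail : ℕ → Vertex × Vertex
    trail zero    = v₀ , proj₁ (continue (v₀ , v₀))
    trail (suc j) = proj₂ (trail j) , proj₁ (continue (trail j))
    adjacent : ∀ j → Adj G (proj₁ (trail j)) (proj₂ (trail j))
    adjacent zero    = proj₁ (proj₂ (continue (v₀ , v₀)))
    adjacent (suc j) = proj₁ (proj₂ (continue (trail j)))

  NonBacktracking : ∀ {u v} → Reach G u v → Set
  NonBacktracking here                          = ⊤
  NonBacktracking (step _ here)                 = ⊤
  NonBacktracking (step {u} _ (step {_} {z} q r)) = z ≢ u × NonBacktracking (step q r)

  nonBacktracking-tail : ∀ {u w v} (p : Adj G u w) (r : Reach G w v) → NonBacktracking (step p r) → NonBacktracking r
  nonBacktracking-tail p here       _  = tt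
  nonBacktracking-tail p (step q r) nb = proj₂ nb

  removeBacktracking : ∀ {u v} → Reach G u v → Σ (Reach G u v) NonBacktracking
  removeBacktracking here = here , tt
  removeBacktracking (step {u} p r) with removeBacktracking r
  ... | here , _ = step p here , tt
  ... | step {_} {z} q r′ , nb with z ≟ᶠ u
  ...   | yes refl = r′ , nonBacktracking-tail q r′ nb
  ...   | no z≢u   = step p (step q r′) , z≢u , nb

  length : ∀ {u v} → Reach G u v → ℕ
  length here       = 0
  length (step _ r) = suc (length r)

  vertexAt : ∀ {u v} → Reach G u v → ℕ → Vertex
  vertexAt {u} here       _       = u
  vertexAt {u} (step _ r) zero    = u
  vertexAt     (step _ r) (suc i) = vertexAt r i

  vertexAt-zero : ∀ {u v} (r : Reach G u v) → vertexAt r 0 ≡ u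
  vertexAt-zero here       = refl
  vertexAt-zero (step _ r) = refl

  vertexAt-length : ∀ {u v} (r : Reach G u v) → vertexAt r (length r) ≡ v
  vertexAt-length here       = refl
  vertexAt-length (step _ r) = vertexAt-length r

  vertexAt-adjacent : ∀ {u v} (r : Reach G u v) {i} → i < length r → Adj G (vertexAt r i) (vertexAt r (suc i))
  vertexAt-adjacent (step p r) {zero}  _         = subst (Adj G _) (sym (vertexAt-zero r)) p
  vertexAt-adjacent (step p r) {suc i} (s≤s i<l) = vertexAt-adjacent r i<l

  vertexAt-nonBacktracking : ∀ {u v} (r : Reach G u v) → NonBacktracking r →
                             ∀ {i} → 2 + i ≤ length r → vertexAt r (2 + i) ≢ vertexAt r i
  vertexAt-nonBacktracking (step p here)       nb (s≤s ())
  vertexAt-nonBacktracking (step p (step q r)) nb {zero}  _ = proj₁ nb ∘ trans (sym (vertexAt-zero r))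
  vertexAt-nonBacktracking (step p (step q r)) nb {suc i} (s≤s 2+i≤l) =
    vertexAt-nonBacktracking (step q r) (proj₂ nb) 2+i≤l

  -- A walk running back and forth along r forever; it reverses only at the branch vertices u and w.
  -- The state (i , forth) stands at vertex i of r, the state (i , back) at vertex 1 + i.
  module Bouncing {u w} (r : Reach G u w) (nb : NonBacktracking r) (0<length : 0 < length r)
                  (u-branch : 3 ≤ deg G u) (w-branch : 3 ≤ deg G w) where

    data Heading : Set where
      forth back : Heading

    position : ℕ × Heading → ℕ
    position (i , forth) = i
    position (i , back)  = suc i

    move : ℕ × Heading → ℕ × Heading
    move (i , forth) with suc i ≟ length r
    ... | yes _ = i , back
    ... | no _  = suc i , forth
    move (zero  , back) = zero , forth
    move (suc i , back) = i , back

    move-< : ∀ s → proj₁ s < length r → proj₁ (move s) < length r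
    move-< (i , forth) i<l with suc i ≟ length r
    ... | yes _     = i<l
    ... | no 1+i≢l  = ≤∧≢⇒< i<l 1+i≢l
    move-< (zero  , back) _   = 0<length
    move-< (suc i , back) 1+i<l = <-trans (n<1+n i) 1+i<l

    move-adjacent : ∀ s → proj₁ s < length r → Adj G (vertexAt r (position s)) (vertexAt r (position (move s)))
    move-adjacent (i , forth) i<l with suc i ≟ length r
    ... | yes _ = vertexAt-adjacent r i<l
    ... | no _  = vertexAt-adjacent r i<l
    move-adjacent (zero  , back) _     = Adj-sym (vertexAt-adjacent r 0<length)
    move-adjacent (suc i , back) 1+i<l = Adj-sym (vertexAt-adjacent r 1+i<l)

    move-turn : ∀ s → proj₁ s < length r →
                vertexAt r (position (move (move s))) ≢ vertexAt r (position s) ⊎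
                3 ≤ deg G (vertexAt r (position (move s)))
    move-turn (i , forth) i<l with suc i ≟ length r
    ... | yes 1+i≡l = inj₂ (subst (λ x → 3 ≤ deg G x) (sym (trans (cong (vertexAt r) 1+i≡l) (vertexAt-length r))) w-branch)
    ... | no 1+i≢l with suc (suc i) ≟ length r
    ...   | yes _ = inj₁ (vertexAt-nonBacktracking r nb (≤∧≢⇒< i<l 1+i≢l))
    ...   | no _  = inj₁ (vertexAt-nonBacktracking r nb (≤∧≢⇒< i<l 1+i≢l))
    move-turn (zero        , back) _ = inj₂ (subst (λ x → 3 ≤ deg G x) (sym (vertexAt-zero r)) u-branch)
    move-turn (suc zero    , back) 2≤l = inj₁ (vertexAt-nonBacktracking r nb 2≤l ∘ sym)
    move-turn (suc (suc i) , back) 3+i≤l = inj₁ (vertexAt-nonBacktracking r nb 3+i≤l ∘ sym)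

    states : ℕ → ℕ × Heading
    states zero    = zero , forth
    states (suc j) = move (states j)

    states-< : ∀ j → proj₁ (states j) < length r
    states-< zero    = 0<length
    states-< (suc j) = move-< (states j) (states-< j)

    forcing : ForcingSequence
    forcing = walk⇒forcing (vertexAt r ∘ position ∘ states)
                          (λ j → move-adjacent (states j) (states-< j))
                          (λ j → move-turn (states j) (states-< j))

  branchVertices⇒forcing : ∀ {u w} → u ≢ w → 3 ≤ deg G u → 3 ≤ deg G w → Reach G u w → ForcingSequence
  branchVertices⇒forcing u≢w u-branch w-branch r with removeBacktracking r
  ... | here       , _  = contradiction refl u≢w
  ... | step p r′ , nb = Bouncing.forcing (step p r′) nb (s≤s z≤n) u-branch w-branch

  -- Graphs of maximum degree two

  module WalkFromLeaf (maxDeg≤2 : ∀ v → deg G v ≤ 2) (x : ℕ → Vertex) (leaf : deg G (x 0) ≤ 1) where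

    IsWalkUpTo : ℕ → Set
    IsWalkUpTo J = (∀ {i} → i < J → Adj G (x i) (x (suc i))) × (∀ {i} → 2 + i ≤ J → x (2 + i) ≢ x i)

    InjectiveUpTo : ℕ → Set
    InjectiveUpTo J = ∀ {a b} → a ≤ J → b ≤ J → x a ≡ x b → a ≡ b

    isWalkUpTo-pred : ∀ {J} → IsWalkUpTo (suc J) → IsWalkUpTo J
    isWalkUpTo-pred (adjacent , noBacktrack) = (adjacent ∘ m≤n⇒m≤1+n) , (noBacktrack ∘ m≤n⇒m≤1+n)

    neighbour-on-walk : ∀ {J a z} → IsWalkUpTo J → InjectiveUpTo J → a < J → Adj G (x a) z →
                        z ≡ x (suc a) ⊎ ∃ λ a′ → a ≡ suc a′ × z ≡ x a′
    neighbour-on-walk {a = zero} (adjacent , _) _ 0<J pz = inj₁ (neighbour-unique leaf (adjacent 0<J) pz)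
    neighbour-on-walk {a = suc a} (adjacent , _) injective a<J pz
      with neighbour-one-of-two (maxDeg≤2 _) (Adj-sym (adjacent (<-trans (n<1+n a) a<J))) (adjacent a<J) x₂≢x₀ pz
      where
      x₂≢x₀ : x (2 + a) ≢ x a
      x₂≢x₀ e with () ← injective a<J (≤-trans (n≤1+n a) (≤-trans (n≤1+n (suc a)) a<J)) e
    ... | inj₁ z≡x₀ = inj₂ (a , refl , z≡x₀)
    ... | inj₂ z≡x₂ = inj₁ z≡x₂

    walk-fresh : ∀ {J b} → IsWalkUpTo (suc J) → InjectiveUpTo J → b ≤ J → x (suc J) ≢ x b
    walk-fresh {J} {b} walk@(adjacent , noBacktrack) injective b≤J e with m≤n⇒m<n∨m≡n b≤J
    ... | inj₂ refl = Adj-irrefl (subst (Adj G (x b)) e (adjacent ≤-refl))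
    ... | inj₁ b<J with neighbour-on-walk (isWalkUpTo-pred walk) injective b<J
                          (subst (λ v → Adj G v (x J)) e (Adj-sym (adjacent ≤-refl)))
    ...   | inj₁ xJ≡x[1+b] = noBacktrack (≤-reflexive (cong suc (sym J≡1+b))) (subst (λ k → x (suc k) ≡ x b) J≡1+b e)
      where
      J≡1+b : J ≡ suc b
      J≡1+b = injective ≤-refl b<J xJ≡x[1+b]
    ...   | inj₂ (b′ , refl , xJ≡xb′) = <-irrefl (sym (injective ≤-refl (≤-trans (n≤1+n b′) (<⇒≤ b<J)) xJ≡xb′))
                                                 (<-trans (n<1+n b′) b<J)

    walk-injective : ∀ J → IsWalkUpTo J → InjectiveUpTo J
    walk-injective zero    _    z≤n z≤n _ = refl
    walk-injective (suc J) walk a≤ b≤ e with m≤n⇒m<n∨m≡n a≤ | m≤n⇒m<n∨m≡n b≤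
    ... | inj₁ a<   | inj₁ b<   = walk-injective J (isWalkUpTo-pred walk) (≤-pred a<) (≤-pred b<) e
    ... | inj₂ refl | inj₁ b<   = contradiction e (walk-fresh walk (walk-injective J (isWalkUpTo-pred walk)) (≤-pred b<))
    ... | inj₁ a<   | inj₂ refl = contradiction (sym e) (walk-fresh walk (walk-injective J (isWalkUpTo-pred walk)) (≤-pred a<))
    ... | inj₂ refl | inj₂ refl = refl

    walk-length< : ∀ {J} → IsWalkUpTo J → J < n G
    walk-length< {J} walk = injective⇒≤ {f = x ∘ toℕ} λ e →
      toℕ-injective (walk-injective J walk (≤-pred (toℕ<n _)) (≤-pred (toℕ<n _)) e)

    module _ {J} (walk : IsWalkUpTo J) (stuck : ∀ {z} → Adj G (x J) z → ∃ λ J′ → J ≡ suc J′ × z ≡ x J′) where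

      private
        injective : InjectiveUpTo J
        injective = walk-injective J walk

      neighbour-index : ∀ {a z} → a ≤ J → Adj G (x a) z →
                        ∃ λ a′ → a′ ≤ J × z ≡ x a′ × (a′ ≡ suc a ⊎ a ≡ suc a′)
      neighbour-index a≤J pz with m≤n⇒m<n∨m≡n a≤J
      ... | inj₁ a<J with neighbour-on-walk walk injective a<J pz
      ...   | inj₁ z≡x[1+a]          = _ , a<J , z≡x[1+a] , inj₁ refl
      ...   | inj₂ (a′ , refl , z≡xa′) = a′ , ≤-trans (n≤1+n a′) a≤J , z≡xa′ , inj₂ refl
      neighbour-index _ pz | inj₂ refl with stuck pz
      ... | J′ , refl , z≡xJ′ = J′ , n≤1+n J′ , z≡xJ′ , inj₂ refl

      reach-on-walk : ∀ {a v} → a ≤ J → Reach G (x a) v → ∃ λ b → b ≤ J × x b ≡ v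
      reach-on-walk {a} a≤J here       = a , a≤J , refl
      reach-on-walk     a≤J (step p r) with neighbour-index a≤J p
      ... | a′ , a′≤J , refl , _ = reach-on-walk a′≤J r

      walk-isPathGraph : Connected G → IsPathGraph G
      walk-isPathGraph (_ , connected) = σ , (σ-injective , σ-surjective) , λ i j → mk⇔ (consecutive i j) (adjacent i j)
        where
        index : ∀ v → ∃ λ b → b ≤ J × x b ≡ v
        index v = reach-on-walk z≤n (connected (x 0) v)
        n≡1+J : n G ≡ suc J
        n≡1+J = ≤-antisym (injective⇒≤ {f = indexFin} indexFin-injective) (walk-length< walk)
          where
          indexFin : Vertex → Fin (suc J)
          indexFin v = fromℕ< (s≤s (proj₁ (proj₂ (index v))))
          indexFin-injective : ∀ {v w} → indexFin v ≡ indexFin w → v ≡ w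
          indexFin-injective {v} {w} e = begin
            v                     ≡⟨ proj₂ (proj₂ (index v)) ⟨
            x (proj₁ (index v))   ≡⟨ cong x (toℕ-fromℕ< _) ⟨
            x (toℕ (indexFin v))  ≡⟨ cong (x ∘ toℕ) e ⟩
            x (toℕ (indexFin w))  ≡⟨ cong x (toℕ-fromℕ< _) ⟩
            x (proj₁ (index w))   ≡⟨ proj₂ (proj₂ (index w)) ⟩
            w                     ∎
            where open ≡-Reasoning
        σ : Fin (n G) → Vertex
        σ i = x (toℕ i)
        toℕ≤J : ∀ (i : Fin (n G)) → toℕ i ≤ J
        toℕ≤J i = ≤-pred (subst (toℕ i <_) n≡1+J (toℕ<n i))
        σ-injective : ∀ {i j} → σ i ≡ σ j → i ≡ j
        σ-injective {i} {j} e = toℕ-injective (injective (toℕ≤J i) (toℕ≤J j) e)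
        σ-surjective : ∀ v → ∃ λ i → ∀ {j} → j ≡ i → σ j ≡ v
        σ-surjective v with index v
        ... | b , b≤J , xb≡v = fromℕ< (subst (b <_) (sym n≡1+J) (s≤s b≤J)) , λ { refl → trans (cong x (toℕ-fromℕ< _)) xb≡v }
        consecutive : ∀ i j → Adj G (σ i) (σ j) → toℕ j ≡ suc (toℕ i) ⊎ toℕ i ≡ suc (toℕ j)
        consecutive i j p with neighbour-index (toℕ≤J i) p
        ... | a′ , a′≤J , σj≡xa′ , inj₁ a′≡1+i = inj₁ (trans (injective (toℕ≤J j) a′≤J σj≡xa′) a′≡1+i)
        ... | a′ , a′≤J , σj≡xa′ , inj₂ i≡1+a′ = inj₂ (trans i≡1+a′ (cong suc (sym (injective (toℕ≤J j) a′≤J σj≡xa′))))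
        adjacent : ∀ i j → toℕ j ≡ suc (toℕ i) ⊎ toℕ i ≡ suc (toℕ j) → Adj G (σ i) (σ j)
        adjacent i j (inj₁ j≡1+i) = subst (λ k → Adj G (σ i) (x k)) (sym j≡1+i) (proj₁ walk (subst (_≤ J) j≡1+i (toℕ≤J j)))
        adjacent i j (inj₂ i≡1+j) = Adj-sym (adjacent j i (inj₁ i≡1+j))

  module _ (maxDeg≤2 : ∀ v → deg G v ≤ 2) {s : Vertex} (leaf : deg G s ≤ 1) where

    Continues : Vertex × Vertex → Set
    Continues (previous , current) = ∃ λ z → Adj G current z × z ≢ previous

    continues? : ∀ e → Dec (Continues e)
    continues? (previous , current) = any? λ z → (adj G current z Bool.≟ true) ×-dec ¬? (z ≟ᶠ previous)

    -- The pairs (previous, current) of the walk from s that never backtracks; it stays put once stuck.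
    trail : ℕ → Vertex × Vertex
    trail zero = s , s
    trail (suc j) with continues? (trail j)
    ... | yes (z , _) = proj₂ (trail j) , z
    ... | no _        = trail j

    private
      x : ℕ → Vertex
      x = proj₂ ∘ trail

    open WalkFromLeaf maxDeg≤2 x leaf

    continue-step : ∀ j → Continues (trail j) →
                    Adj G (x j) (x (suc j)) × x (suc j) ≢ proj₁ (trail j) × proj₁ (trail (suc j)) ≡ x j
    continue-step j continues with continues? (trail j)
    ... | yes (_ , p , z≢previous) = p , z≢previous , refl
    ... | no stop                  = contradiction continues stop

    ContinuesBefore : ℕ → Set
    ContinuesBefore J = ∀ {i} → i < J → Continues (trail i)

    trail-isWalkUpTo : ∀ {J} → ContinuesBefore J → IsWalkUpTo J
    trail-isWalkUpTo continues = (λ i<J → proj₁ (continue-step _ (continues i<J))) , λ {i} 2+i≤J x₂≡x₀ →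
      proj₁ (proj₂ (continue-step (suc i) (continues 2+i≤J)))
            (trans x₂≡x₀ (sym (proj₂ (proj₂ (continue-step i (continues (<-trans (n<1+n i) 2+i≤J)))))))

    first-stop : ∀ j → ContinuesBefore j ⊎ ∃ λ J → ContinuesBefore J × ¬ Continues (trail J)
    first-stop zero = inj₁ λ ()
    first-stop (suc j) with first-stop j
    ... | inj₂ stopped = inj₂ stopped
    ... | inj₁ continuesBefore with continues? (trail j)
    ...   | no stop     = inj₂ (j , continuesBefore , stop)
    ...   | yes continues = inj₁ λ i<1+j → case m≤n⇒m<n∨m≡n (≤-pred i<1+j) of λ where
              (inj₁ i<j)  → continuesBefore i<j
              (inj₂ refl) → continues

    stuck : ∀ J → ContinuesBefore J → ¬ Continues (trail J) →
            ∀ {z} → Adj G (x J) z → ∃ λ J′ → J ≡ suc J′ × z ≡ x J′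
    stuck J _ stop {z} p with z ≟ᶠ proj₁ (trail J)
    ... | no z≢previous = contradiction (z , p , z≢previous) stop
    stuck zero     _               _ p | yes z≡s        = contradiction (subst (Adj G s) z≡s p) Adj-irrefl
    stuck (suc J′) continuesBefore _ _ | yes z≡previous =
      J′ , refl , trans z≡previous (proj₂ (proj₂ (continue-step J′ (continuesBefore ≤-refl))))

    leaf⇒isPathGraph : Connected G → IsPathGraph G
    leaf⇒isPathGraph connected with first-stop (n G)
    ... | inj₁ continuesBefore = contradiction (walk-length< (trail-isWalkUpTo continuesBefore)) (<-irrefl refl)
    ... | inj₂ (J , continuesBefore , stop) =
      walk-isPathGraph (trail-isWalkUpTo continuesBefore) (stuck J continuesBefore stop) connected

  -- Acyclicity, needed to recognise an extended star, is only available as the negation of a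
  -- cycle; hence the double negation.
  ¬¬forcing : Connected G → ¬ IsPathGraph G → ¬ IsExtendedStar G → ¬ ¬ ForcingSequence
  ¬¬forcing connected@(0<n , reach) notPath notStar noForcing
    with any? (λ u → any? (λ w → ¬? (u ≟ᶠ w) ×-dec ((3 ≤? deg G u) ×-dec (3 ≤? deg G w))))
  ... | yes (u , w , u≢w , u-branch , w-branch) =
    noForcing (branchVertices⇒forcing u≢w u-branch w-branch (reach u w))
  ... | no noBranchPair with any? (λ v → 3 ≤? deg G v)
  ...   | yes (v , v-branch) = notStar ((connected , noForcing ∘ cycle⇒forcing) , v , v-branch , unique)
    where
    unique : ∀ w → 3 ≤ deg G w → w ≡ v
    unique w w-branch = decidable-stable (w ≟ᶠ v) λ w≢v → noBranchPair (w , v , w≢v , w-branch , v-branch)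
  ...   | no noBranch with any? (λ s → deg G s ≤? 1)
  ...     | yes (s , leaf) = notPath (leaf⇒isPathGraph (λ v → ≤-pred (≰⇒> (noBranch ∘ (v ,_)))) leaf connected)
  ...     | no noLeaf      = noForcing (minDeg≥2⇒forcing (λ v → ≰⇒> (noLeaf ∘ (v ,_))) (fromℕ< 0<n))

  circularlyPartite : ∀ K .{{_ : NonZero K}} (c : Colouring K) → Onto c → IsCircular c → CircularlyPartite G K
  circularlyPartite (suc K) c onto circular = c , onto , circular

  divisor-circularlyPartite : ∀ {k m} → 1 ≤ k → k ∣ m → CircularlyPartite G m → CircularlyPartite G k
  divisor-circularlyPartite {suc k} {suc m} _ k∣m (c , onto , circular) =
    circularlyPartite (suc k) (residues (suc k) (labels c))
      (residues-onto (∣⇒≤ k∣m) onto) (residues-circular (circularModulo-∣ k∣m (labels-circular circular)))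

  lcm-circularlyPartite : ForcingSequence → ∀ {k m} → CircularlyPartite G k → CircularlyPartite G m →
                          CircularlyPartite G (lcm k m)
  lcm-circularlyPartite forcing {suc k} {suc m} (c₁ , _ , circular₁) (c₂ , _ , circular₂) =
    circularlyPartite L c (forcing⇒onto forcing circular) circular
    where
    L : ℕ
    L = lcm (suc k) (suc m)
    instance
      lcm-nonZero : NonZero (lcm (suc k) (suc m))
      lcm-nonZero = lcm≢0 (suc k) (suc m)
    c : Colouring L
    c = residues L (λ v w p → pairing (suc k) (suc m) (labels c₁ v w p) (labels c₂ v w p))
    circular : IsCircular c
    circular = residues-circular
      (circularModulo-lcm {ℓ₁ = labels c₁} {labels c₂} (labels-circular circular₁) (labels-circular circular₂))

  divides-maximal : ForcingSequence → ∀ {k m} → CircularlyPartite G k → CircularlyPartite G m →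
                    (∀ j → CircularlyPartite G j → j ≤ m) → k ∣ m
  divides-maximal forcing {suc k} {suc m} k-partite m-partite maximal =
    subst (suc k ∣_) lcm≡m (m∣lcm[m,n] (suc k) (suc m))
    where
    instance
      lcm-nonZero : NonZero (lcm (suc k) (suc m))
      lcm-nonZero = lcm≢0 (suc k) (suc m)
    lcm≡m : lcm (suc k) (suc m) ≡ suc m
    lcm≡m = ≤-antisym (maximal _ (lcm-circularlyPartite forcing k-partite m-partite)) (∣⇒≤ (n∣lcm[m,n] (suc k) (suc m)))

theorem3p1 : (G : Graph) → Connected G → ¬ IsPathGraph G → ¬ IsExtendedStar G →
    (m : ℕ) → IsChiO G m →
    (k : ℕ) → 1 ≤ k → (CircularlyPartite G k ⇔ (k ∣ m))
theorem3p1 G connected notPath notStar m (m-partite , maximal) k 1≤k = mk⇔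
  (λ k-partite → decidable-stable (k ∣? m)
     (¬¬-map (λ forcing → divides-maximal G forcing k-partite m-partite maximal) (¬¬forcing G connected notPath notStar)))
  (λ k∣m → divisor-circularlyPartite G 1≤k k∣m m-partite)
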